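{- Let $K=k\mathbb{Z}$ with $k\geq 1$ an integer, and let $C\subseteq\mathbb{Z}$ be a union of cosets of $K$ such that $\lambda_{\mathbb{Z}}(C)>2$, i.e. the number of residue classes modulo $k$ contained in $C$ is greater than twice the number of residue classes modulo $k$ contained in $\mathbb{Z}\setminus C$. Then for any finite subset $E$ of $C$ and any proper subset $F$ of $\mathbb{Z}\setminus C$, the set $(C\setminus E)\cup F$ is not a minimal complement in $\mathbb{Z}$.
   Context: For subsets $A,B$ of $\mathbb{Z}$, $A+B=\{a+b\}$. $A$ is a complement to $B$ if $A+B=\mathbb{Z}$, and a minimal complement to $B$ if moreover no proper subset of $A$ is a complement to $B$. A subset of $\mathbb{Z}$ is a minimal complement in $\mathbb{Z}$ if it is a minimal complement to some nonempty subset of $\mathbb{Z}$. For $C$ a union of cosets of $K$, the relative quotient $\lambda_{\mathbb{Z}}(C)$ is interpreted as (number of cosets of $K$ in $C$)/(number of cosets of $K$ in $\mathbb{Z}\setminus C$). -}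

module Defs where

open import Level using (0ℓ)
open import Data.Nat as ℕ using (ℕ; NonZero)
open import Data.Integer using (ℤ; _+_; _%ℕ_)
open import Data.Integer.DivMod using (n%ℕd<d)
open import Data.Fin using (Fin; fromℕ<)
open import Data.Fin.Subset using (Subset; _∈_; _∉_)
open import Data.List using (List)
import Data.List.Membership.Propositional as LM
open import Data.Product using (Σ; ∃; _×_)
open import Data.Sum using (_⊎_)
open import Relation.Nullary using (¬_)
open import Relation.Binary.PropositionalEquality using (_≡_)
open import Relation.Unary using (Pred; _⊆_)

SetZ : Set₁
SetZ = Pred ℤ 0ℓ

residue : (k : ℕ) .{{_ : NonZero k}} → ℤ → Fin k
residue k x = fromℕ< (n%ℕd<d x k)

cosetUnion : (k : ℕ) .{{_ : NonZero k}} → Subset k → SetZ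
cosetUnion k S x = residue k x ∈ S

IsComplement : SetZ → SetZ → Set
IsComplement A B = ∀ z → ∃ λ a → ∃ λ b → A a × B b × z ≡ a + b

_⊂_ : SetZ → SetZ → Set
A' ⊂ A = A' ⊆ A × ∃ λ x → A x × ¬ A' x

IsMinimalComplementTo : SetZ → SetZ → Set₁
IsMinimalComplementTo A B =
  IsComplement A B × (∀ (A' : SetZ) → A' ⊂ A → ¬ IsComplement A' B)

IsMinimalComplement : SetZ → Set₁
IsMinimalComplement A = Σ SetZ λ B → (∃ λ b → B b) × IsMinimalComplementTo A B

-- (C \ E) ∪ F, with E a finite set given by a list
diffUnion : SetZ → List ℤ → SetZ → SetZ
diffUnion C E F x = (C x × ¬ (x LM.∈ E)) ⊎ F x

module Submission where

open import Defs
open import Data.Nat using (ℕ; NonZero; _*_; _<_)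
open import Data.Integer using (ℤ)
open import Data.Fin.Subset using (Subset; ∣_∣; ∁)
open import Data.List using (List)
open import Data.List.Relation.Unary.All using (All)
open import Relation.Nullary using (¬_)
open import Relation.Unary using (_⊆_)

open import Data.Nat as ℕ using (zero; suc; _≤_; z≤n; s≤s)
import Data.Nat.Properties as ℕP
open import Data.Integer as ℤ using (+_; _+_; _-_; _%ℕ_; _/ℕ_)
import Data.Integer.Properties as ℤP
open import Data.Integer.DivMod using (n%ℕd<d; a≡a%ℕn+[a/ℕn]*n)
open import Data.Integer.Tactic.RingSolver using (solve-∀)
open import Data.Fin using (Fin; zero; suc; toℕ; combine; remQuot)
import Data.Fin.Properties as FP
open import Data.Fin.Properties using (any?)
open import Data.Fin.Subset using (_∈_; _∪_; inside; outside) renaming (_-_ to _∖_)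
open import Data.Fin.Subset.Properties
  using (_∈?_; ∣p∣≤∣x∷p∣; x∈p∧x≢y⇒x∈p-y; x∈p⇒∣p-x∣<∣p∣; x∈p∪q⁺; x∈∁p⇒x∉p; x∉p⇒x∈∁p)
open import Data.Vec.Base using ([]; _∷_; here; there; tabulate) renaming (lookup to lookupᵥ)
open import Data.Vec.Properties using (lookup∘tabulate; []=⇒lookup; lookup⇒[]=)
open import Data.List using (length; lookup; map)
import Data.List.Relation.Unary.All as All
open import Data.List.Relation.Unary.All.Properties using (map⁻)
import Data.List.Relation.Unary.Any as Any
open import Data.List.Relation.Unary.Any.Properties using (lookup-index)
open import Data.List.Membership.Propositional using () renaming (_∈_ to _∈ₗ_)
open import Data.List.Membership.DecPropositional ℤ._≟_ using () renaming (_∈?_ to _∈ₗ?_)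
open import Data.List.Extrema.Nat using (max; xs≤max)
open import Data.Product using (∃; _,_; _×_; proj₁; proj₂)
open import Data.Sum using (_⊎_; inj₁; inj₂)
open import Data.Empty using (⊥; ⊥-elim)
open import Function using (_∘_)
open import Relation.Nullary using (Dec; yes; no; ¬?; _×-dec_)
open import Relation.Nullary.Negation using (¬¬-map)
open import Relation.Nullary.Decidable using (¬¬-excluded-middle)
open import Relation.Binary.PropositionalEquality

-- Let C = cosetUnion k S (λ(C) > 2 means 2 ∣∁ S∣ < ∣S∣) and
-- A = (C ∖ E) ∪ F, and suppose A is a minimal complement to a nonempty B.
-- F misses a point outside C, so A ≠ ℤ and B has two distinct elements
-- (another-element).  Fix finitely many elements of B meeting every residue
-- class that B meets, two of them distinct, say r₀ ≠ r₁ (Representatives).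
-- For each class α ⊆ C, minimality gives an isolating point z = a + b with
-- a ∈ α, b ∈ B, and z - r ∉ C or z - r = a for every representative r
-- (isolation-exists): of ∣E∣·#reps + 1 fresh elements a of α, removing any
-- one must break A + B = ℤ, and by pigeonhole not every failure can be
-- caused by the finitely many points of E + reps.  The map α ↦ z mod k is
-- injective on S with values in (r₀ + ∁ S) ∪ (r₁ + ∁ S), so ∣S∣ ≤ 2 ∣∁ S∣
-- (isolation-bound), a contradiction.  As B need not be decidable, these
-- choices are made under ¬ ¬ (harmless, the goal being ⊥), using excluded
-- middle only for finitely many propositions.


preimage : ∀ {n m} → (Fin n → Fin m) → Subset m → Subset n
preimage g T = tabulate (λ x → lookupᵥ T (g x))

∈-preimage⁺ : ∀ {n m} (g : Fin n → Fin m) T {x} → g x ∈ T → x ∈ preimage g T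
∈-preimage⁺ g T {x} gx∈T = lookup⇒[]= x _ (trans (lookup∘tabulate _ x) ([]=⇒lookup gx∈T))

∈-preimage⁻ : ∀ {n m} (g : Fin n → Fin m) T {x} → x ∈ preimage g T → g x ∈ T
∈-preimage⁻ g T {x} x∈pre = lookup⇒[]= (g x) T (trans (sym (lookup∘tabulate _ x)) ([]=⇒lookup x∈pre))

∣p∪q∣≤∣p∣+∣q∣ : ∀ {n} (p q : Subset n) → ∣ p ∪ q ∣ ≤ ∣ p ∣ ℕ.+ ∣ q ∣
∣p∪q∣≤∣p∣+∣q∣ []            []            = z≤n
∣p∪q∣≤∣p∣+∣q∣ (inside ∷ p)  (s ∷ q)       =
  s≤s (ℕP.≤-trans (∣p∪q∣≤∣p∣+∣q∣ p q) (ℕP.+-monoʳ-≤ ∣ p ∣ (∣p∣≤∣x∷p∣ s q)))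
∣p∪q∣≤∣p∣+∣q∣ (outside ∷ p) (inside ∷ q)  =
  ℕP.≤-trans (s≤s (∣p∪q∣≤∣p∣+∣q∣ p q)) (ℕP.≤-reflexive (sym (ℕP.+-suc ∣ p ∣ ∣ q ∣)))
∣p∪q∣≤∣p∣+∣q∣ (outside ∷ p) (outside ∷ q) = ∣p∪q∣≤∣p∣+∣q∣ p q

injection-bound : ∀ {n m} (P : Subset n) (Q : Subset m) (f : ∀ x → x ∈ P → Fin m) →
  (∀ x x∈P → f x x∈P ∈ Q) →
  (∀ x y x∈P y∈P → f x x∈P ≡ f y y∈P → x ≡ y) → ∣ P ∣ ≤ ∣ Q ∣
injection-bound []            Q f into inj = z≤n
injection-bound (outside ∷ P) Q f into inj =
  injection-bound P Q (λ x x∈P → f (suc x) (there x∈P)) (λ x x∈P → into (suc x) (there x∈P))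
    (λ x y x∈P y∈P eq → FP.suc-injective (inj (suc x) (suc y) (there x∈P) (there y∈P) eq))
injection-bound (inside ∷ P)  Q f into inj =
  ℕP.≤-trans (s≤s rest) (x∈p⇒∣p-x∣<∣p∣ (into zero here))
  where
  rest : ∣ P ∣ ≤ ∣ Q ∖ f zero here ∣
  rest = injection-bound P (Q ∖ f zero here) (λ x x∈P → f (suc x) (there x∈P))
    (λ x x∈P → x∈p∧x≢y⇒x∈p-y (into (suc x) (there x∈P))
                 (λ eq → FP.0≢1+n (inj zero (suc x) here (there x∈P) (sym eq))))
    (λ x y x∈P y∈P eq → FP.suc-injective (inj (suc x) (suc y) (there x∈P) (there y∈P) eq))

module Residues (k : ℕ) .{{_ : NonZero k}} where

  remainder-unique : ∀ {r r'} q q' → r ℕ.< k → r' ℕ.< k →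
                     + r + q ℤ.* + k ≡ + r' + q' ℤ.* + k → r ≡ r'
  remainder-unique {r} {r'} q q' r<k r'<k eq =
    ℤP.+-injective (ℤP.i-j≡0⇒i≡j (+ r) (+ r') (trans difference
      (cong (ℤ._* + k) (ℤP.∣i∣≡0⇒i≡0 {q' - q} quotient-zero))))
    where
    open ≡-Reasoning
    difference : + r - + r' ≡ (q' - q) ℤ.* + k
    difference = begin
      + r - + r'                             ≡⟨ expand (+ r) (+ r') (q ℤ.* + k) ⟩
      (+ r + q ℤ.* + k) - + r' - q ℤ.* + k   ≡⟨ cong (λ v → v - + r' - q ℤ.* + k) eq ⟩
      (+ r' + q' ℤ.* + k) - + r' - q ℤ.* + k ≡⟨ collect (+ r') q' q (+ k) ⟩
      (q' - q) ℤ.* + k                       ∎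
      where
      expand : ∀ a b c → a - b ≡ (a + c) - b - c
      expand = solve-∀
      collect : ∀ a x y z → (a + x ℤ.* z) - a - y ℤ.* z ≡ (x - y) ℤ.* z
      collect = solve-∀
    small : ℤ.∣ + r - + r' ∣ ℕ.< k
    small = ℕP.≤-<-trans (ℕP.≤-reflexive (cong ℤ.∣_∣ (ℤP.[+m]-[+n]≡m⊖n r r')))
              (ℕP.≤-<-trans (ℤP.∣m⊝n∣≤m⊔n r r') (ℕP.⊔-lub r<k r'<k))
    quotient-zero : ℤ.∣ q' - q ∣ ≡ 0
    quotient-zero = ℕP.n<1⇒n≡0 (ℕP.*-cancelʳ-< k _ 1 (subst (ℕ._< 1 ℕ.* k)
      (trans (cong ℤ.∣_∣ difference) (ℤP.abs-* (q' - q) (+ k)))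
      (subst (ℤ.∣ + r - + r' ∣ ℕ.<_) (sym (ℕP.*-identityˡ k)) small)))

  %ℕ-unique : ∀ {x r} q → r ℕ.< k → x ≡ + r + q ℤ.* + k → x %ℕ k ≡ r
  %ℕ-unique {x} q r<k eq =
    remainder-unique (x /ℕ k) q (n%ℕd<d x k) r<k (trans (sym (a≡a%ℕn+[a/ℕn]*n x k)) eq)

  residue-cong : ∀ x y → x %ℕ k ≡ y %ℕ k → residue k x ≡ residue k y
  residue-cong x y eq = FP.fromℕ<-cong _ _ eq (n%ℕd<d x k) (n%ℕd<d y k)

  residue⇒%ℕ : ∀ x y → residue k x ≡ residue k y → x %ℕ k ≡ y %ℕ k
  residue⇒%ℕ x y eq =
    trans (sym (FP.toℕ-fromℕ< (n%ℕd<d x k))) (trans (cong toℕ eq) (FP.toℕ-fromℕ< (n%ℕd<d y k)))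

  residue-+multiple : ∀ x q → residue k (x + q ℤ.* + k) ≡ residue k x
  residue-+multiple x q = residue-cong (x + q ℤ.* + k) x (%ℕ-unique (x /ℕ k + q) (n%ℕd<d x k) (begin
    x + q ℤ.* + k                             ≡⟨ cong (_+ q ℤ.* + k) (a≡a%ℕn+[a/ℕn]*n x k) ⟩
    (+ (x %ℕ k) + x /ℕ k ℤ.* + k) + q ℤ.* + k ≡⟨ regroup (+ (x %ℕ k)) (x /ℕ k) q (+ k) ⟩
    + (x %ℕ k) + (x /ℕ k + q) ℤ.* + k         ∎))
    where
    open ≡-Reasoning
    regroup : ∀ r a b c → (r + a ℤ.* c) + b ℤ.* c ≡ r + (a + b) ℤ.* c
    regroup = solve-∀

  residue-toℕ : ∀ (τ : Fin k) → residue k (+ toℕ τ) ≡ τ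
  residue-toℕ τ = trans
    (FP.fromℕ<-cong _ _ (%ℕ-unique (+ 0) (FP.toℕ<n τ) (sym (ℤP.+-identityʳ (+ toℕ τ))))
      (n%ℕd<d (+ toℕ τ) k) (FP.toℕ<n τ))
    (FP.fromℕ<-toℕ τ (FP.toℕ<n τ))

  congruent : ∀ x y → residue k x ≡ residue k y → x ≡ y + (x /ℕ k - y /ℕ k) ℤ.* + k
  congruent x y eq = begin
    x                                     ≡⟨ a≡a%ℕn+[a/ℕn]*n x k ⟩
    + (x %ℕ k) + x /ℕ k ℤ.* + k           ≡⟨ cong (λ r → + r + x /ℕ k ℤ.* + k) (residue⇒%ℕ x y eq) ⟩
    + (y %ℕ k) + x /ℕ k ℤ.* + k           ≡⟨ regroup (+ (y %ℕ k)) (x /ℕ k) (y /ℕ k) (+ k) ⟩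
    (+ (y %ℕ k) + y /ℕ k ℤ.* + k) + q ℤ.* + k
                                          ≡⟨ cong (_+ q ℤ.* + k) (a≡a%ℕn+[a/ℕn]*n y k) ⟨
    y + q ℤ.* + k                         ∎
    where
    open ≡-Reasoning
    q = x /ℕ k - y /ℕ k
    regroup : ∀ r a b c → r + a ℤ.* c ≡ (r + b ℤ.* c) + (a - b) ℤ.* c
    regroup = solve-∀

  residue-sub : ∀ x x' y y' → residue k x ≡ residue k x' → residue k y ≡ residue k y' →
                residue k (x - y) ≡ residue k (x' - y')
  residue-sub x x' y y' ex ey = begin
    residue k (x - y)
      ≡⟨ cong₂ (λ u v → residue k (u - v)) (congruent x x' ex) (congruent y y' ey) ⟩
    residue k ((x' + qx ℤ.* + k) - (y' + qy ℤ.* + k))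
      ≡⟨ cong (residue k) (regroup x' y' qx qy (+ k)) ⟩
    residue k ((x' - y') + (qx - qy) ℤ.* + k)
      ≡⟨ residue-+multiple (x' - y') (qx - qy) ⟩
    residue k (x' - y')
      ∎
    where
    open ≡-Reasoning
    qx = x /ℕ k - x' /ℕ k
    qy = y /ℕ k - y' /ℕ k
    regroup : ∀ a b c d e → (a + c ℤ.* e) - (b + d ℤ.* e) ≡ (a - b) + (c - d) ℤ.* e
    regroup = solve-∀

open Residues

[x+y]-y≡x : ∀ x y → x + y - y ≡ x
[x+y]-y≡x = solve-∀

[x+y]-x≡y : ∀ x y → x + y - x ≡ y
[x+y]-x≡y = solve-∀

x-y+y≡x : ∀ x y → x - y + y ≡ x
x-y+y≡x = solve-∀

x+[y-x]≡y : ∀ x y → x + (y - x) ≡ y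
x+[y-x]≡y = solve-∀

x-[x-y]≡y : ∀ x y → x - (x - y) ≡ y
x-[x-y]≡y = solve-∀

+-cancelʳ : ∀ {x x' y} → x + y ≡ x' + y → x ≡ x'
+-cancelʳ {x} {x'} {y} eq = trans (sym ([x+y]-y≡x x y)) (trans (cong (_- y) eq) ([x+y]-y≡x x' y))

−-cancelˡ : ∀ z {r r'} → z - r ≡ z - r' → r ≡ r'
−-cancelˡ z {r} {r'} eq = trans (sym (x-[x-y]≡y z r)) (trans (cong (z -_) eq) (x-[x-y]≡y z r'))

¬¬-shift : ∀ n {P : Fin n → Set} → (∀ i → ¬ ¬ P i) → ¬ ¬ (∀ i → P i)
¬¬-shift zero    ¬¬P ¬∀P = ¬∀P (λ ())
¬¬-shift (suc n) ¬¬P ¬∀P = ¬¬P zero λ P₀ →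
  ¬¬-shift n (λ i → ¬¬P (suc i)) λ P₊ → ¬∀P λ { zero → P₀ ; (suc i) → P₊ i }

¬¬-under-premise : {P Q : Set} → (P → ¬ ¬ Q) → ¬ ¬ (P → Q)
¬¬-under-premise ¬¬Q ¬[P→Q] = ¬[P→Q] λ p → ⊥-elim (¬¬Q p λ q → ¬[P→Q] λ _ → q)

another-element : ∀ {A B : SetZ} → IsComplement A B → ∀ {x₀} → ¬ A x₀ →
                  ∀ {b} → B b → ∃ λ b' → B b' × b' ≢ b
another-element {A} complement {x₀} x₀∉A {b} _ with complement (x₀ + b)
... | a , b' , a∈A , b'∈B , x₀+b≡a+b' = b' , b'∈B , λ { refl →
  x₀∉A (subst A (sym (+-cancelʳ x₀+b≡a+b')) a∈A) }

module Fresh (k : ℕ) .{{_ : NonZero k}} (E : List ℤ) (α : Fin k) where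

  bound : ℕ
  bound = max 0 (map ℤ.∣_∣ E)

  fresh : ℕ → ℤ
  fresh i = + (toℕ α ℕ.+ (suc bound ℕ.+ i) * k)

  fresh-residue : ∀ i → residue k (fresh i) ≡ α
  fresh-residue i = begin
    residue k (fresh i)                  ≡⟨ cong (residue k) (ℤP.pos-+ (toℕ α) (n * k)) ⟩
    residue k (+ toℕ α + + (n * k))      ≡⟨ cong (λ v → residue k (+ toℕ α + v)) (ℤP.pos-* n k) ⟩
    residue k (+ toℕ α + + n ℤ.* + k)    ≡⟨ residue-+multiple k (+ toℕ α) (+ n) ⟩
    residue k (+ toℕ α)                  ≡⟨ residue-toℕ k α ⟩
    α                                    ∎
    where
    open ≡-Reasoning
    n = suc bound ℕ.+ i

  -- fresh i exceeds the absolute value of every element of E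
  fresh-∉ : ∀ i → ¬ (fresh i ∈ₗ E)
  fresh-∉ i fresh∈E =
    ℕP.<⇒≱ bound<fresh (All.lookup (map⁻ (xs≤max 0 (map ℤ.∣_∣ E))) fresh∈E)
    where
    bound<fresh : bound ℕ.< toℕ α ℕ.+ (suc bound ℕ.+ i) * k
    bound<fresh = ℕP.≤-trans (ℕP.m≤m+n (suc bound) i)
      (ℕP.≤-trans (ℕP.m≤m*n _ k) (ℕP.m≤n+m _ (toℕ α)))

  fresh-injective : ∀ i j → fresh i ≡ fresh j → i ≡ j
  fresh-injective i j eq = ℕP.+-cancelˡ-≡ (suc bound) i j
    (ℕP.*-cancelʳ-≡ _ _ k (ℕP.+-cancelˡ-≡ (toℕ α) _ _ (ℤP.+-injective eq)))

module MinimalComplement (k : ℕ) .{{_ : NonZero k}} (S : Subset k) (E : List ℤ)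
  (A B : SetZ)
  (C∖E⊆A : ∀ {x} → cosetUnion k S x → ¬ (x ∈ₗ E) → A x)
  (complement : IsComplement A B)
  (minimal : ∀ A' → A' ⊂ A → ¬ IsComplement A' B) where

  record Representatives : Set where
    field
      size     : ℕ
      rep      : Fin size → ℤ
      rep∈B    : ∀ c → B (rep c)
      meets    : ∀ b → B b → ∃ λ c → residue k (rep c) ≡ residue k b
      c₀ c₁    : Fin size
      distinct : rep c₀ ≢ rep c₁

  -- Classically one representative per residue class can be chosen; since
  -- there are only k classes this holds constructively under ¬ ¬.
  representatives : ∀ {p q} → B p → B q → p ≢ q → ¬ ¬ Representatives
  representatives {p} {q} p∈B q∈B p≢q =
    ¬¬-map build (¬¬-shift k (λ _ → ¬¬-excluded-middle))
    where
    Met : Fin k → Set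
    Met ρ = ∃ λ b → B b × residue k b ≡ ρ

    build : (∀ ρ → Dec (Met ρ)) → Representatives
    build met? = record
      { size = 2 ℕ.+ k ; rep = rep ; rep∈B = rep∈B ; meets = meets
      ; c₀ = zero ; c₁ = suc zero ; distinct = p≢q }
      where
      choose : ∀ {ρ} → Dec (Met ρ) → ℤ
      choose (yes (b , _)) = b
      choose (no _)        = p

      choose∈B : ∀ {ρ} (d : Dec (Met ρ)) → B (choose d)
      choose∈B (yes (_ , b∈B , _)) = b∈B
      choose∈B (no _)              = p∈B

      choose-residue : ∀ {ρ} (d : Dec (Met ρ)) → Met ρ → residue k (choose d) ≡ ρ
      choose-residue (yes (_ , _ , eq)) _ = eq
      choose-residue (no ¬met)       met = ⊥-elim (¬met met)

      rep : Fin (2 ℕ.+ k) → ℤ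
      rep zero             = p
      rep (suc zero)       = q
      rep (suc (suc ρ))    = choose (met? ρ)

      rep∈B : ∀ c → B (rep c)
      rep∈B zero          = p∈B
      rep∈B (suc zero)    = q∈B
      rep∈B (suc (suc ρ)) = choose∈B (met? ρ)

      meets : ∀ b → B b → ∃ λ c → residue k (rep c) ≡ residue k b
      meets b b∈B = suc (suc (residue k b)) , choose-residue (met? _) (b , b∈B , refl)

  module WithRepresentatives (R : Representatives) where
    open Representatives R

    -- An isolating point for the class α: z = a + b with a ≡ α (mod k),
    -- b ∈ B, such that for every representative r, z - r is either a
    -- itself or lies outside C.  (This is the finite shadow of the fact
    -- that, by minimality, a is the only element of A in z - B.)
    record Isolation (α : Fin k) : Set where
      field
        z a b    : ℤ
        b∈B      : B b
        z≡a+b    : z ≡ a + b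
        a-class  : residue k a ≡ α
        isolates : ∀ c → residue k (z - rep c) ∈ ∁ S ⊎ z - rep c ≡ a

    translate : ℤ → Fin k → Fin k
    translate r τ = residue k (+ toℕ τ - r)

    translate-residue : ∀ r x → translate r (residue k x) ≡ residue k (x - r)
    translate-residue r x =
      residue-sub k (+ toℕ (residue k x)) x r r (residue-toℕ k (residue k x)) refl

    translate-injective : ∀ r σ τ → translate r σ ≡ translate r τ → σ ≡ τ
    translate-injective r σ τ eq = begin
      σ                               ≡⟨ residue-toℕ k σ ⟨
      residue k (+ toℕ σ)             ≡⟨ cong (residue k) (undo (+ toℕ σ) r) ⟨
      residue k (+ toℕ σ - r - ℤ.- r) ≡⟨ residue-sub k (+ toℕ σ - r) (+ toℕ τ - r) (ℤ.- r) (ℤ.- r) eq refl ⟩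
      residue k (+ toℕ τ - r - ℤ.- r) ≡⟨ cong (residue k) (undo (+ toℕ τ) r) ⟩
      residue k (+ toℕ τ)             ≡⟨ residue-toℕ k τ ⟩
      τ                               ∎
      where
      open ≡-Reasoning
      undo : ∀ x r → x - r - ℤ.- r ≡ x
      undo = solve-∀

    -- Shifted r: the classes τ with τ - r outside C.  Translation by -r maps
    -- it injectively into ∁ S, so it has at most ∣ ∁ S ∣ elements.
    Shifted : ℤ → Subset k
    Shifted r = preimage (translate r) (∁ S)

    ∣Shifted∣ : ∀ r → ∣ Shifted r ∣ ≤ ∣ ∁ S ∣
    ∣Shifted∣ r = injection-bound (Shifted r) (∁ S) (λ τ _ → translate r τ)
      (λ τ τ∈ → ∈-preimage⁻ (translate r) (∁ S) τ∈)
      (λ σ τ _ _ → translate-injective r σ τ)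

    outside⇒shifted : ∀ r z → residue k (z - r) ∈ ∁ S → residue k z ∈ Shifted r
    outside⇒shifted r z out =
      ∈-preimage⁺ (translate r) (∁ S) (subst (_∈ ∁ S) (sym (translate-residue r z)) out)

    -- Since r₀ ≠ r₁, an isolating point z has z - r₀ or z - r₁ outside C.
    isolation-shifted : ∀ {α} (I : Isolation α) →
      residue k (Isolation.z I) ∈ Shifted (rep c₀) ∪ Shifted (rep c₁)
    isolation-shifted I = pick (isolates c₀) (isolates c₁)
      where
      open Isolation I
      pick : residue k (z - rep c₀) ∈ ∁ S ⊎ z - rep c₀ ≡ a →
             residue k (z - rep c₁) ∈ ∁ S ⊎ z - rep c₁ ≡ a →
             residue k z ∈ Shifted (rep c₀) ∪ Shifted (rep c₁)
      pick (inj₁ out₀) _           = x∈p∪q⁺ (inj₁ (outside⇒shifted (rep c₀) z out₀))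
      pick (inj₂ _)    (inj₁ out₁) = x∈p∪q⁺ (inj₂ (outside⇒shifted (rep c₁) z out₁))
      pick (inj₂ eq₀)  (inj₂ eq₁)  = ⊥-elim (distinct (−-cancelˡ z (trans eq₀ (sym eq₁))))

    -- Isolating points of different classes of C have different residues:
    -- if z_α ≡ z_β (mod k), take the representative r of the class of b_β;
    -- then z_α - r ≡ z_β - b_β = a_β lies in C, so isolation forces
    -- z_α - r = a_α, whence α = β.
    isolation-injective : ∀ {α β} (I : Isolation α) (J : Isolation β) → β ∈ S →
      residue k (Isolation.z I) ≡ residue k (Isolation.z J) → α ≡ β
    isolation-injective {α} {β} I J β∈S z≡z with meets (Isolation.b J) (Isolation.b∈B J)
    ... | c , r≡b = settle (Isolation.isolates I c)
      where
      module I = Isolation I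
      module J = Isolation J
      lands-in-β : residue k (I.z - rep c) ≡ β
      lands-in-β = begin
        residue k (I.z - rep c)     ≡⟨ residue-sub k I.z J.z (rep c) J.b z≡z r≡b ⟩
        residue k (J.z - J.b)       ≡⟨ cong (λ v → residue k (v - J.b)) J.z≡a+b ⟩
        residue k (J.a + J.b - J.b) ≡⟨ cong (residue k) ([x+y]-y≡x J.a J.b) ⟩
        residue k J.a               ≡⟨ J.a-class ⟩
        β                           ∎
        where open ≡-Reasoning
      settle : residue k (I.z - rep c) ∈ ∁ S ⊎ I.z - rep c ≡ I.a → α ≡ β
      settle (inj₁ out) = ⊥-elim (x∈∁p⇒x∉p (subst (_∈ ∁ S) lands-in-β out) β∈S)
      settle (inj₂ eq)  = trans (sym I.a-class) (trans (cong (residue k) (sym eq)) lands-in-β)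

    isolation-bound : (∀ α → α ∈ S → Isolation α) → ∣ S ∣ ≤ 2 * ∣ ∁ S ∣
    isolation-bound iso = begin
      ∣ S ∣                             ≤⟨ S↪Shifted ⟩
      ∣ Shifted r₀ ∪ Shifted r₁ ∣       ≤⟨ ∣p∪q∣≤∣p∣+∣q∣ (Shifted r₀) (Shifted r₁) ⟩
      ∣ Shifted r₀ ∣ ℕ.+ ∣ Shifted r₁ ∣ ≤⟨ ℕP.+-mono-≤ (∣Shifted∣ r₀) (∣Shifted∣ r₁) ⟩
      ∣ ∁ S ∣ ℕ.+ ∣ ∁ S ∣               ≡⟨ cong (∣ ∁ S ∣ ℕ.+_) (ℕP.+-identityʳ ∣ ∁ S ∣) ⟨
      2 * ∣ ∁ S ∣                       ∎
      where
      open ℕP.≤-Reasoning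
      r₀ = rep c₀
      r₁ = rep c₁
      S↪Shifted : ∣ S ∣ ≤ ∣ Shifted r₀ ∪ Shifted r₁ ∣
      S↪Shifted = injection-bound S (Shifted r₀ ∪ Shifted r₁)
        (λ α α∈S → residue k (Isolation.z (iso α α∈S)))
        (λ α α∈S → isolation-shifted (iso α α∈S))
        (λ α β α∈S β∈S → isolation-injective (iso α α∈S) (iso β β∈S) β∈S)

    module _ (α : Fin k) (α∈S : α ∈ S) where
      open Fresh k E α

      m : ℕ
      m = length E * size

      critical : Fin m → ℤ
      critical x = lookup E (proj₁ e,c) + rep (proj₂ e,c)
        where e,c = remQuot {length E} size x

      critical-hit : ∀ w c → w - rep c ∈ₗ E → ∃ λ x → critical x ≡ w
      critical-hit w c w-r∈E = combine {length E} {size} e c , (begin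
        critical (combine e c) ≡⟨ cong (λ (e' , c') → lookup E e' + rep c')
                                        (FP.remQuot-combine {length E} {size} e c) ⟩
        lookup E e + rep c     ≡⟨ cong (_+ rep c) (lookup-index w-r∈E) ⟨
        w - rep c + rep c      ≡⟨ x-y+y≡x w (rep c) ⟩
        w                      ∎)
        where
        open ≡-Reasoning
        e = Any.index w-r∈E

      a : Fin (suc m) → ℤ
      a j = fresh (toℕ j)

      a∈A : ∀ j → A (a j)
      a∈A j = C∖E⊆A (subst (_∈ S) (sym (fresh-residue (toℕ j))) α∈S) (fresh-∉ (toℕ j))

      a-injective : ∀ i j → a i ≡ a j → i ≡ j
      a-injective i j eq = FP.toℕ-injective (fresh-injective (toℕ i) (toℕ j) eq)

      A-without : Fin (suc m) → SetZ
      A-without j x = A x × x ≢ a j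

      A-without⊂A : ∀ j → A-without j ⊂ A
      A-without⊂A j = proj₁ , a j , a∈A j , λ (_ , a≢a) → a≢a refl

      -- Removing a j from A is obstructed at a critical point z when
      -- z - a j ∈ B but z - a i ∉ B for all i ≠ j.
      Obstructed : Fin (suc m) → Set
      Obstructed j = ∃ λ x → B (critical x - a j) × (∀ i → i ≢ j → ¬ B (critical x - a i))

      -- A critical point obstructs at most one j, and there are only m of them.
      not-all-obstructed : ¬ (∀ j → Obstructed j)
      not-all-obstructed obs with FP.pigeonhole (ℕP.n<1+n m) (λ j → proj₁ (obs j))
      ... | i , j , i<j , same-point =
        proj₂ (proj₂ (obs i)) j (≢-sym (FP.<⇒≢ i<j))
          (subst (λ x → B (critical x - a j)) (sym same-point) (proj₁ (proj₂ (obs j))))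

      module _ (B? : ∀ x i → Dec (B (critical x - a i))) where

        -- y could replace a j in a representation: y ∈ C ∖ E and y ≠ a j
        Usable : Fin (suc m) → ℤ → Set
        Usable j y = residue k y ∈ S × ¬ (y ∈ₗ E) × y ≢ a j

        usable? : ∀ j y → Dec (Usable j y)
        usable? j y = (residue k y ∈? S) ×-dec (¬? (y ∈ₗ? E) ×-dec ¬? (y ℤ.≟ a j))

        isolation : ∀ j {b} → B b → (∀ c → ¬ Usable j (a j + b - rep c)) →
                    (∀ c → ¬ (a j + b - rep c ∈ₗ E)) → Isolation α
        isolation j {b} b∈B unusable avoids = record
          { z = a j + b ; a = a j ; b = b ; b∈B = b∈B ; z≡a+b = refl
          ; a-class = fresh-residue (toℕ j) ; isolates = isolates }
          where
          isolates : ∀ c → residue k (a j + b - rep c) ∈ ∁ S ⊎ a j + b - rep c ≡ a j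
          isolates c with residue k (a j + b - rep c) ∈? S | a j + b - rep c ℤ.≟ a j
          ... | no ∉S  | _      = inj₁ (x∉p⇒x∈∁p ∉S)
          ... | yes _  | yes eq = inj₂ eq
          ... | yes ∈S | no ≢aj = ⊥-elim (unusable c (∈S , avoids c , ≢aj))

        RepresentedWithout : Fin (suc m) → ℤ → Set
        RepresentedWithout j w = ∃ λ a' → ∃ λ b' → A-without j a' × B b' × w ≡ a' + b'

        trichotomy : ∀ j {b} → B b → RepresentedWithout j (a j + b) ⊎ Isolation α ⊎ Obstructed j
        trichotomy j {b} b∈B with any? (λ c → usable? j (a j + b - rep c))
        ... | yes (c , y∈C , y∉E , y≢aj) = inj₁
          (a j + b - rep c , rep c , (C∖E⊆A y∈C y∉E , y≢aj) , rep∈B c ,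
           sym (x-y+y≡x (a j + b) (rep c)))
        ... | no none with any? (λ c → a j + b - rep c ∈ₗ? E)
        ... | no avoids = inj₂ (inj₁ (isolation j b∈B (λ c u → none (c , u)) (λ c h → avoids (c , h))))
        ... | yes (c , hit) with critical-hit (a j + b) c hit
        ... | x , crit≡w with any? (λ i → ¬? (i FP.≟ j) ×-dec B? x i)
        ... | yes (i , i≢j , b'∈B) = inj₁
          (a i , critical x - a i , (a∈A i , i≢j ∘ a-injective i j) , b'∈B ,
           trans (sym crit≡w) (sym (x+[y-x]≡y (a i) (critical x))))
        ... | no unobstructed =
          inj₂ (inj₂ (x , subst B b≡ b∈B , λ i i≢j b'∈B → unobstructed (i , i≢j , b'∈B)))
          where
          b≡ : b ≡ critical x - a j
          b≡ = trans (sym ([x+y]-x≡y (a j) b)) (cong (_- a j) (sym crit≡w))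

        without-is-complement : ¬ Isolation α → ∀ j → ¬ Obstructed j → IsComplement (A-without j) B
        without-is-complement ¬iso j ¬obs w with complement w
        ... | a' , b , a'∈A , b∈B , w≡a'+b with a' ℤ.≟ a j
        ... | no a'≢aj = a' , b , (a'∈A , a'≢aj) , b∈B , w≡a'+b
        ... | yes refl with trichotomy j b∈B
        ... | inj₁ (a'' , b' , a''∈ , b'∈B , eq) = a'' , b' , a''∈ , b'∈B , trans w≡a'+b eq
        ... | inj₂ (inj₁ iso) = ⊥-elim (¬iso iso)
        ... | inj₂ (inj₂ obs) = ⊥-elim (¬obs obs)

      -- By minimality no A ∖ {a j} is a complement, so (¬ ¬) every a j is
      -- obstructed, which the pigeonhole principle forbids.
      isolation-exists : ¬ ¬ Isolation α
      isolation-exists ¬iso =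
        ¬¬-shift m (λ x → ¬¬-shift (suc m) (λ i → ¬¬-excluded-middle)) λ B? →
        ¬¬-shift (suc m)
          (λ j ¬obs → minimal (A-without j) (A-without⊂A j) (without-is-complement B? ¬iso j ¬obs))
          not-all-obstructed

  no-two-elements : 2 * ∣ ∁ S ∣ < ∣ S ∣ → ∀ {p q} → B p → B q → p ≢ q → ⊥
  no-two-elements λ>2 p∈B q∈B p≢q = representatives p∈B q∈B p≢q λ R →
    let open WithRepresentatives R in
    ¬¬-shift k (λ α → ¬¬-under-premise (isolation-exists α)) λ iso →
    ℕP.<⇒≱ λ>2 (isolation-bound iso)

corollary2p5 : (k : ℕ) .{{_ : NonZero k}} (S : Subset k) →
    2 * ∣ ∁ S ∣ < ∣ S ∣ →
    (E : List ℤ) → All (cosetUnion k S) E →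
    (F : SetZ) → F ⊂ (λ x → ¬ cosetUnion k S x) →
    ¬ IsMinimalComplement (diffUnion (cosetUnion k S) E F)
corollary2p5 k S λ>2 E _ F (_ , x₀ , x₀∉C , x₀∉F) (B , (b , b∈B) , complement , minimal) =
  let (b' , b'∈B , b'≢b) = another-element complement x₀∉A b∈B in
  MinimalComplement.no-two-elements k S E A B (λ x∈C x∉E → inj₁ (x∈C , x∉E))
    complement minimal λ>2 b'∈B b∈B b'≢b
  where
  A : SetZ
  A = diffUnion (cosetUnion k S) E F

  x₀∉A : ¬ A x₀
  x₀∉A (inj₁ (x₀∈C , _)) = x₀∉C x₀∈C
  x₀∉A (inj₂ x₀∈F)       = x₀∉F x₀∈F
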